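{- Let $\sigma$ be a primitive substitution on an alphabet with $d$ letters, prolongable on the letter $a$. Then $R_\sigma \le 2|\sigma^{2d^2}|$.
   Context: A substitution is an endomorphism $\sigma$ of $A^*$ ($A$ finite) that is growing ($\min_{b}|\sigma^n(b)|\to\infty$); it is prolongable on $a$ if $\sigma(a)=au$ with $u$ nonempty, and then $\sigma^\infty(a)$ is the limit of $\sigma^n(a)$. It is primitive if some power of its incidence matrix ($m_{i,j}$ = number of occurrences of $i$ in $\sigma(j)$) has all entries positive. $|\tau|=\max_{b\in A}|\tau(b)|$. The language $\mathcal L(\sigma)$ is the set of words occurring in some $\sigma^n(b)$, $b\in A$ (for primitive $\sigma$ prolongable on $a$ this equals the set of factors of $\sigma^\infty(a)$). $R_\sigma$ denotes the maximal difference between two successive occurrences of a word of length $2$ of $\mathcal{L}(\sigma)$ in words of $\mathcal L(\sigma)$ (equivalently, in $\sigma^\infty(a)$). -}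

module Defs where

open import Data.Nat using (ℕ; zero; suc; _+_; _*_; _≤_; _<_; _⊔_; _∸_)
open import Data.Fin using (Fin; toℕ)
open import Data.Fin.Properties using (_≟_)
open import Data.List using (List; []; _∷_; _++_; length; concatMap; foldr; map)
open import Data.Nat.ListAction using (sum)
open import Data.Product using (Σ; ∃; ∃-syntax; _×_; _,_)
open import Data.List using (allFin)
open import Relation.Binary.PropositionalEquality using (_≡_; _≢_)
open import Relation.Nullary using (¬_; does)
open import Data.Bool using (if_then_else_)

Word : ℕ → Set
Word d = List (Fin d)

Morphism : ℕ → Set
Morphism d = Fin d → Word d

apply : ∀ {d} → Morphism d → Word d → Word d
apply σ w = concatMap σ w

pow : ∀ {d} → Morphism d → ℕ → Morphism d
pow σ zero b = b ∷ []
pow σ (suc n) b = apply σ (pow σ n b)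

Growing : ∀ {d} → Morphism d → Set
Growing {d} σ = ∀ (M : ℕ) → ∃[ N ] ∀ n → N ≤ n → ∀ (b : Fin d) → M ≤ length (pow σ n b)

-- substitution = growing endomorphism
-- prolongable on a: σ(a) = a u with u nonempty
ProlongableOn : ∀ {d} → Morphism d → Fin d → Set
ProlongableOn σ a = ∃[ u ] (σ a ≡ a ∷ u) × (u ≢ [])

count : ∀ {d} → Fin d → Word d → ℕ
count i [] = 0
count i (x ∷ w) = (if does (i ≟ x) then 1 else 0) + count i w

Matrix : ℕ → Set
Matrix d = Fin d → Fin d → ℕ

incidence : ∀ {d} → Morphism d → Matrix d
incidence σ i j = count i (σ j)

matMul : ∀ {d} → Matrix d → Matrix d → Matrix d
matMul {d} M N i j = sum (map (λ k → M i k * N k j) (allFin d))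

identity : ∀ {d} → Matrix d
identity i j = if does (i ≟ j) then 1 else 0

matPow : ∀ {d} → Matrix d → ℕ → Matrix d
matPow M zero = identity
matPow M (suc n) = matMul M (matPow M n)

Primitive : ∀ {d} → Morphism d → Set
Primitive σ = ∃[ k ] ∀ i j → 0 < matPow (incidence σ) k i j

maxLen : ∀ {d} → Morphism d → ℕ
maxLen {d} τ = foldr (λ b m → length (τ b) ⊔ m) 0 (allFin d)

Factor : ∀ {d} → Word d → Word d → Set
Factor w v = ∃[ p ] ∃[ s ] (p ++ w ++ s ≡ v)

InLanguage : ∀ {d} → Morphism d → Word d → Set
InLanguage {d} σ w = ∃[ n ] ∃[ b ] Factor w (pow σ n b)

OccursAt : ∀ {d} → Word d → Word d → ℕ → Set
OccursAt w v i = ∃[ p ] ∃[ s ] (length p ≡ i) × (p ++ w ++ s ≡ v)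

SuccessiveOcc : ∀ {d} → Word d → Word d → ℕ → ℕ → Set
SuccessiveOcc w v i j =
  i < j × OccursAt w v i × OccursAt w v j × (∀ k → i < k → k < j → ¬ OccursAt w v k)

-- R_σ ≤ R : every difference of two successive occurrences of a length-2
-- word of L(σ) in a word of L(σ) is at most R (R_σ is the maximum of these).
ReturnBound : ∀ {d} → Morphism d → ℕ → Set
ReturnBound σ R = ∀ w v i j → InLanguage σ w → length w ≡ 2 → InLanguage σ v →
  SuccessiveOcc w v i j → j ∸ i ≤ R

module Submission where

-- Let σ be growing, primitive and prolongable on a, and put K = 2d².
-- The proof has two halves.
--
-- (1) Every two-letter word xy of L(σ) occurs in σ^K(c) for every letter c.
--     Since σ(a) = a u, the words σ^n(a) form a chain of prefixes, so the sets
--     of pairs occurring in σ^{m+1}(a) increase with m; by primitivity every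
--     word of L(σ) occurs in some σ^n(a).  Because σ erases no letter, the
--     pairs of σ(w) are determined by the pairs of w, so as soon as this chain
--     is stationary for one step it is stationary forever; a counting argument
--     on the d² possible pairs makes it stationary after fewer than d² steps.
--     The same argument for the letters e with a ∈ σ^m(e) shows that a occurs
--     in σ^m(e) for all e with some m < d.  Together: xy ⊑ σ^{K-m}(a) ⊑ σ^K(c).
--
-- (2) If every block B(c) has length ≤ L and contains an occurrence of a
--     nonempty word w, then in a concatenation of blocks an occurrence of w
--     follows each position within 2L, unless the word ends first; hence two
--     successive occurrences of w in any factor are at most 2L apart.
--
-- Every word of L(σ) is a factor of σ^K(σ^n(a)) for some n, so (2) applied
-- to the blocks σ^K(c) together with (1) gives the theorem.

open import Defs
open import Data.Nat using (ℕ; zero; suc; _+_; _*_; _∸_; _⊔_; _≤_; _<_; _≤′_; ≤′-refl; ≤′-step; z≤n; s≤s; _≤?_)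
open import Data.Nat.Properties hiding (_≟_)
open import Data.Nat.ListAction using (sum)
open import Data.Fin using (Fin)
open import Data.Fin.Properties using (_≟_)
open import Data.List using (List; []; _∷_; _++_; length; map; foldr; allFin; cartesianProduct)
open import Data.List.Properties using (++-assoc; ++-identityʳ; length-++; length-map; length-tabulate; concatMap-++; concatMap-pure; ∷-injectiveˡ; ∷-injectiveʳ)
open import Data.List.Membership.Propositional using (_∈_; lose; find)
open import Data.List.Membership.Propositional.Properties using (∈-allFin; ∈-cartesianProduct⁺; ∈-concatMap⁺; ∈-concatMap⁻)
open import Data.List.Relation.Unary.Any using (Any; here; there; any?)
open import Data.Product using (∃; ∃-syntax; _×_; _,_; proj₁; proj₂)
open import Data.Sum using (_⊎_; inj₁; inj₂)
open import Data.Empty using (⊥-elim)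
open import Relation.Nullary using (¬_; Dec; yes; no; ¬?; _×-dec_)
open import Relation.Binary.PropositionalEquality

private
  variable
    d : ℕ

apply-apply : (σ τ : Morphism d) (w : Word d) →
  apply σ (apply τ w) ≡ apply (λ b → apply σ (τ b)) w
apply-apply σ τ [] = refl
apply-apply σ τ (b ∷ w) = begin
  apply σ (τ b ++ apply τ w)                       ≡⟨ concatMap-++ σ (τ b) (apply τ w) ⟩
  apply σ (τ b) ++ apply σ (apply τ w)             ≡⟨ cong (apply σ (τ b) ++_) (apply-apply σ τ w) ⟩
  apply σ (τ b) ++ apply (λ c → apply σ (τ c)) w   ∎
  where open ≡-Reasoning

pow-+ : (σ : Morphism d) (m n : ℕ) (e : Fin d) → pow σ (m + n) e ≡ apply (pow σ m) (pow σ n e)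
pow-+ σ zero    n e = sym (concatMap-pure (pow σ n e))
pow-+ σ (suc m) n e = trans (cong (apply σ) (pow-+ σ m n e)) (apply-apply σ (pow σ m) (pow σ n e))

pow-suc-inner : (σ : Morphism d) (m : ℕ) (e : Fin d) → pow σ (suc m) e ≡ apply (pow σ m) (σ e)
pow-suc-inner σ m e = begin
  pow σ (suc m) e              ≡⟨ cong (λ n → pow σ n e) (+-comm 1 m) ⟩
  pow σ (m + 1) e              ≡⟨ pow-+ σ m 1 e ⟩
  apply (pow σ m) (σ e ++ [])  ≡⟨ cong (apply (pow σ m)) (++-identityʳ (σ e)) ⟩
  apply (pow σ m) (σ e)        ∎
  where open ≡-Reasoning

∈-apply⁺ : (f : Morphism d) {w : Word d} {y z : Fin d} → z ∈ w → y ∈ f z → y ∈ apply f w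
∈-apply⁺ f z∈w y∈fz = ∈-concatMap⁺ f (lose z∈w y∈fz)

∈-apply⁻ : (f : Morphism d) (w : Word d) {y : Fin d} → y ∈ apply f w → ∃[ z ] (z ∈ w × y ∈ f z)
∈-apply⁻ f w y∈fw = find (∈-concatMap⁻ f y∈fw)

factor-++ʳ : {v u : Word d} (r : Word d) → Factor v u → Factor v (u ++ r)
factor-++ʳ {v = v} r (p , s , refl) =
  p , s ++ r , trans (cong (p ++_) (sym (++-assoc v s r))) (sym (++-assoc p (v ++ s) r))

factor-apply : (f : Morphism d) {v : Word d} {z : Fin d} (w : Word d) → z ∈ w → Factor v (f z) →
  Factor v (apply f w)
factor-apply f (z ∷ w) (here refl) fac = factor-++ʳ (apply f w) fac
factor-apply f (z ∷ w) (there z∈w) fac with factor-apply f w z∈w fac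
... | p , s , eq = f z ++ p , s , trans (++-assoc (f z) p _) (cong (f z ++_) eq)

maxLen-≥ : (τ : Morphism d) (b : Fin d) → length (τ b) ≤ maxLen τ
maxLen-≥ {d} τ b = go (allFin d) (∈-allFin b)
  where
    go : (bs : List (Fin d)) → b ∈ bs → length (τ b) ≤ foldr (λ c m → length (τ c) ⊔ m) 0 bs
    go (_ ∷ bs) (here refl) = m≤m⊔n _ _
    go (_ ∷ bs) (there b∈bs) = ≤-trans (go bs b∈bs) (m≤n⊔m _ _)

NonEmpty : Word d → Set
NonEmpty w = ∃[ h ] ∃[ t ] (w ≡ h ∷ t)

NonErasing : Morphism d → Set
NonErasing σ = ∀ b → NonEmpty (σ b)

-- A growing morphism erases no letter: if σ(b) = [] then σ^{N+1}(b) = σ^N(σ b) = [] for all N.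
growing⇒nonErasing : (σ : Morphism d) → Growing σ → NonErasing σ
growing⇒nonErasing σ growing b with growing 1
... | N , long with σ b in eq | long (suc N) (n≤1+n N) b
... | h ∷ t | _ = h , t , refl
... | []    | 1≤len = ⊥-elim (<-irrefl refl (subst (λ w → 1 ≤ length w)
                        (trans (pow-suc-inner σ N b) (cong (apply (pow σ N)) eq)) 1≤len))

apply-nonEmpty : (f : Morphism d) → NonErasing f → ∀ w → NonEmpty w → NonEmpty (apply f w)
apply-nonEmpty f ne (z ∷ w) _ with ne z
... | h , t , eq = h , t ++ apply f w , cong (_++ apply f w) eq

pow-nonErasing : (σ : Morphism d) → NonErasing σ → ∀ n → NonErasing (pow σ n)
pow-nonErasing σ ne zero    z = z , [] , refl
pow-nonErasing σ ne (suc n) z = apply-nonEmpty σ ne (pow σ n z) (pow-nonErasing σ ne n z)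

sum-positive : {A : Set} (f : A → ℕ) (xs : List A) → 0 < sum (map f xs) → ∃[ x ] (0 < f x)
sum-positive f (x ∷ xs) pos with f x in eq
... | suc _ = x , subst (0 <_) (sym eq) (s≤s z≤n)
... | zero  = sum-positive f xs pos

*-positive⁻ : (m n : ℕ) → 0 < m * n → 0 < m × 0 < n
*-positive⁻ (suc m) zero pos = ⊥-elim (<-irrefl refl (subst (0 <_) (*-zeroʳ (suc m)) pos))
*-positive⁻ (suc m) (suc n) _ = s≤s z≤n , s≤s z≤n

count-positive⇒∈ : (i : Fin d) (w : Word d) → 0 < count i w → i ∈ w
count-positive⇒∈ i (x ∷ w) pos with i ≟ x
... | yes refl = here refl
... | no  _    = there (count-positive⇒∈ i w pos)

-- The (i,j) entry of M_σ^k counts the occurrences of i in σ^k(j); we only need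
-- that a positive entry yields an occurrence.
matPow-positive⇒∈ : (σ : Morphism d) (k : ℕ) (i j : Fin d) → 0 < matPow (incidence σ) k i j → i ∈ pow σ k j
matPow-positive⇒∈ σ zero i j pos with i ≟ j
... | yes refl = here refl
... | no  _    = ⊥-elim (<-irrefl refl pos)
matPow-positive⇒∈ {d} σ (suc k) i j pos
  with sum-positive (λ l → incidence σ i l * matPow (incidence σ) k l j) (allFin d) pos
... | l , pos-l with *-positive⁻ (incidence σ i l) _ pos-l
... | i∈σl , l∈σᵏj = ∈-apply⁺ σ (matPow-positive⇒∈ σ k l j l∈σᵏj) (count-positive⇒∈ i (σ l) i∈σl)

data Adj {d} (x y : Fin d) : Word d → Set where
  here  : ∀ {u} → Adj x y (x ∷ y ∷ u)
  there : ∀ {z u} → Adj x y u → Adj x y (z ∷ u)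

adj? : (x y : Fin d) (u : Word d) → Dec (Adj x y u)
adj? x y [] = no λ ()
adj? x y (z ∷ []) = no λ { (there ()) }
adj? x y (z ∷ z′ ∷ u) with x ≟ z | y ≟ z′ | adj? x y (z′ ∷ u)
... | yes refl | yes refl | _       = yes here
... | _        | _        | yes adj = yes (there adj)
... | no x≢z   | _        | no ¬adj = no λ { here → x≢z refl ; (there adj) → ¬adj adj }
... | yes _    | no y≢z′  | no ¬adj = no λ { here → y≢z′ refl ; (there adj) → ¬adj adj }

adj-++⁺ˡ : {x y : Fin d} (p q : Word d) → Adj x y p → Adj x y (p ++ q)
adj-++⁺ˡ (_ ∷ _ ∷ _) q here = here
adj-++⁺ˡ (_ ∷ p) q (there adj) = there (adj-++⁺ˡ p q adj)

adj-++⁺ʳ : {x y : Fin d} (p q : Word d) → Adj x y q → Adj x y (p ++ q)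
adj-++⁺ʳ [] q adj = adj
adj-++⁺ʳ (_ ∷ p) q adj = there (adj-++⁺ʳ p q adj)

EndsWith : Fin d → Word d → Set
EndsWith x p = ∃[ p₀ ] (p ≡ p₀ ++ x ∷ [])

StartsWith : Fin d → Word d → Set
StartsWith y q = ∃[ q₀ ] (q ≡ y ∷ q₀)

adj-++⁻ : {x y : Fin d} (p q : Word d) → Adj x y (p ++ q) →
  Adj x y p ⊎ Adj x y q ⊎ (EndsWith x p × StartsWith y q)
adj-++⁻ [] q adj = inj₂ (inj₁ adj)
adj-++⁻ (_ ∷ []) (_ ∷ q) here = inj₂ (inj₂ (([] , refl) , (q , refl)))
adj-++⁻ (_ ∷ []) q (there adj) = inj₂ (inj₁ adj)
adj-++⁻ (_ ∷ _ ∷ p) q here = inj₁ here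
adj-++⁻ (z ∷ z′ ∷ p) q (there adj) with adj-++⁻ (z′ ∷ p) q adj
... | inj₁ inP = inj₁ (there inP)
... | inj₂ (inj₁ inQ) = inj₂ (inj₁ inQ)
... | inj₂ (inj₂ ((p₀ , eq) , start)) = inj₂ (inj₂ ((z ∷ p₀ , cong (z ∷_) eq) , start))

adj-boundary : {x y : Fin d} (p q : Word d) → EndsWith x p → StartsWith y q → Adj x y (p ++ q)
adj-boundary {x = x} {y} _ _ (p₀ , refl) (q₀ , refl) =
  subst (Adj x y) (sym (++-assoc p₀ (x ∷ []) (y ∷ q₀))) (adj-++⁺ʳ p₀ _ here)

adj⇒∈ˡ : {x y : Fin d} {u : Word d} → Adj x y u → x ∈ u
adj⇒∈ˡ here = here refl
adj⇒∈ˡ (there adj) = there (adj⇒∈ˡ adj)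

adj⇒∈ʳ : {x y : Fin d} {u : Word d} → Adj x y u → y ∈ u
adj⇒∈ʳ here = there (here refl)
adj⇒∈ʳ (there adj) = there (adj⇒∈ʳ adj)

Factor⇒Adj : {x y : Fin d} {u : Word d} → Factor (x ∷ y ∷ []) u → Adj x y u
Factor⇒Adj (p , s , refl) = adj-++⁺ʳ p _ here

Long : Word d → Set
Long u = ∃[ p ] ∃[ q ] ∃[ r ] (u ≡ p ∷ q ∷ r)

long-++ : (p q : Word d) → NonEmpty p → NonEmpty q → Long (p ++ q)
long-++ (h ∷ [])     (h′ ∷ t′) _ _ = h , h′ , t′ , refl
long-++ (h ∷ h₂ ∷ t) q         _ _ = h , h₂ , t ++ q , refl

long⇒adj : {u : Word d} → Long u → ∃[ x ] ∃[ y ] Adj x y u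
long⇒adj (p , q , r , refl) = p , q , here

∈-long⇒adj : {z p q : Fin d} (r : Word d) → z ∈ p ∷ q ∷ r →
  (∃[ y ] Adj z y (p ∷ q ∷ r)) ⊎ (∃[ x ] Adj x z (p ∷ q ∷ r))
∈-long⇒adj {q = q} r (here refl) = inj₁ (q , here)
∈-long⇒adj {p = p} r (there (here refl)) = inj₂ (p , here)
∈-long⇒adj (r₁ ∷ r) (there (there z∈r)) with ∈-long⇒adj r (there z∈r)
... | inj₁ (y , adj) = inj₁ (y , there adj)
... | inj₂ (x , adj) = inj₂ (x , there adj)

Pairs⊆ : Word d → Word d → Set
Pairs⊆ u′ u = ∀ x y → Adj x y u′ → Adj x y u

module PairsOfImage (σ : Morphism d) (ne : NonErasing σ) where

  startsWith-apply : {y : Fin d} (u : Word d) → StartsWith y (apply σ u) →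
    ∃[ z ] ∃[ u′ ] (u ≡ z ∷ u′ × StartsWith y (σ z))
  startsWith-apply [] (_ , ())
  startsWith-apply (z ∷ u′) (q₀ , eq) with ne z
  ... | h , t , eq′ = z , u′ , refl , t ,
          trans eq′ (cong (_∷ t) (∷-injectiveˡ (trans (sym (cong (_++ apply σ u′) eq′)) eq)))

  adj-apply⁻ : {x y : Fin d} (u : Word d) → Adj x y (apply σ u) →
    (∃[ z ] (z ∈ u × Adj x y (σ z))) ⊎
    (∃[ z₁ ] ∃[ z₂ ] (Adj z₁ z₂ u × EndsWith x (σ z₁) × StartsWith y (σ z₂)))
  adj-apply⁻ (z ∷ u) adj with adj-++⁻ (σ z) (apply σ u) adj
  ... | inj₁ inBlock = inj₁ (z , here refl , inBlock)
  ... | inj₂ (inj₁ inRest) with adj-apply⁻ u inRest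
  ...   | inj₁ (z′ , z′∈u , inBlock) = inj₁ (z′ , there z′∈u , inBlock)
  ...   | inj₂ (z₁ , z₂ , pair , end , start) = inj₂ (z₁ , z₂ , there pair , end , start)
  adj-apply⁻ (z ∷ u) adj | inj₂ (inj₂ (end , start)) with startsWith-apply u start
  ... | z′ , u′ , refl , start′ = inj₂ (z , z′ , here , end , start′)

  adj-apply-inside : {x y z : Fin d} (u : Word d) → z ∈ u → Adj x y (σ z) → Adj x y (apply σ u)
  adj-apply-inside (z ∷ u) (here refl) adj = adj-++⁺ˡ (σ z) _ adj
  adj-apply-inside (z ∷ u) (there z∈u) adj = adj-++⁺ʳ (σ z) _ (adj-apply-inside u z∈u adj)

  adj-apply-across : {x y z₁ z₂ : Fin d} (u : Word d) → Adj z₁ z₂ u →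
    EndsWith x (σ z₁) → StartsWith y (σ z₂) → Adj x y (apply σ u)
  adj-apply-across (z₁ ∷ z₂ ∷ u) here end start =
    subst (Adj _ _) (++-assoc (σ z₁) (σ z₂) (apply σ u))
      (adj-++⁺ˡ (σ z₁ ++ σ z₂) _ (adj-boundary (σ z₁) (σ z₂) end start))
  adj-apply-across (z ∷ u) (there pair) end start = adj-++⁺ʳ (σ z) _ (adj-apply-across u pair end start)

  -- The pairs of σ(u′) are determined by the pairs of u′ (for u′ of length ≥ 2,
  -- whose letters are then all covered by its pairs).
  pairs-apply : (u′ u : Word d) → Long u′ → Pairs⊆ u′ u → Pairs⊆ (apply σ u′) (apply σ u)
  pairs-apply u′ u (p , q , r , refl) sub x y adj with adj-apply⁻ (p ∷ q ∷ r) adj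
  ... | inj₂ (z₁ , z₂ , pair , end , start) = adj-apply-across u (sub _ _ pair) end start
  ... | inj₁ (z , z∈u′ , inBlock) with ∈-long⇒adj r z∈u′
  ...   | inj₁ (_ , pair) = adj-apply-inside u (adj⇒∈ˡ (sub _ _ pair)) inBlock
  ...   | inj₂ (_ , pair) = adj-apply-inside u (adj⇒∈ʳ (sub _ _ pair)) inBlock

module _ {X : Set} where

  countSat : {Q : X → Set} → (∀ x → Dec (Q x)) → List X → ℕ
  countSat Q? [] = 0
  countSat Q? (x ∷ xs) with Q? x
  ... | yes _ = suc (countSat Q? xs)
  ... | no  _ = countSat Q? xs

  countSat-≤ : {Q : X → Set} (Q? : ∀ x → Dec (Q x)) (xs : List X) → countSat Q? xs ≤ length xs
  countSat-≤ Q? [] = z≤n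
  countSat-≤ Q? (x ∷ xs) with Q? x
  ... | yes _ = s≤s (countSat-≤ Q? xs)
  ... | no  _ = m≤n⇒m≤1+n (countSat-≤ Q? xs)

  countSat-positive : {Q : X → Set} (Q? : ∀ x → Dec (Q x)) {x : X} (xs : List X) → x ∈ xs → Q x →
    1 ≤ countSat Q? xs
  countSat-positive Q? (y ∷ xs) x∈xs qx with Q? y
  ... | yes _ = s≤s z≤n
  countSat-positive Q? (y ∷ xs) (here refl) qx | no ¬qy = ⊥-elim (¬qy qx)
  countSat-positive Q? (y ∷ xs) (there x∈xs) qx | no _ = countSat-positive Q? xs x∈xs qx

  countSat-mono : {P Q : X → Set} (P? : ∀ x → Dec (P x)) (Q? : ∀ x → Dec (Q x)) → (∀ x → P x → Q x) →
    (xs : List X) → countSat P? xs ≤ countSat Q? xs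
  countSat-mono P? Q? P⊆Q [] = z≤n
  countSat-mono P? Q? P⊆Q (x ∷ xs) with P? x | Q? x
  ... | yes _  | yes _  = s≤s (countSat-mono P? Q? P⊆Q xs)
  ... | yes px | no ¬qx = ⊥-elim (¬qx (P⊆Q x px))
  ... | no _   | yes _  = m≤n⇒m≤1+n (countSat-mono P? Q? P⊆Q xs)
  ... | no _   | no _   = countSat-mono P? Q? P⊆Q xs

  countSat-strict : {P Q : X → Set} (P? : ∀ x → Dec (P x)) (Q? : ∀ x → Dec (Q x)) → (∀ x → P x → Q x) →
    (xs : List X) → Any (λ x → Q x × ¬ P x) xs → suc (countSat P? xs) ≤ countSat Q? xs
  countSat-strict P? Q? P⊆Q (x ∷ xs) new with P? x | Q? x | new
  ... | yes px | _      | here (_ , ¬px) = ⊥-elim (¬px px)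
  ... | _      | no ¬qx | here (qx , _)  = ⊥-elim (¬qx qx)
  ... | no _   | yes _  | _              = s≤s (countSat-mono P? Q? P⊆Q xs)
  ... | yes _  | yes _  | there new′     = s≤s (countSat-strict P? Q? P⊆Q xs new′)
  ... | yes px | no ¬qx | there _        = ⊥-elim (¬qx (P⊆Q x px))
  ... | no _   | no _   | there new′     = countSat-strict P? Q? P⊆Q xs new′

  Stationary : (P : ℕ → X → Set) → ℕ → Set
  Stationary P m = ∀ x → P (suc m) x → P m x

  -- An increasing chain P 0 ⊆ P 1 ⊆ … of decidable subsets of a type enumerated by xs,
  -- with P 0 nonempty and such that one stationary step forces the next, is constant
  -- from some step m < |xs| on: each non-stationary step adds an element.
  module Stabilisation (xs : List X) (complete : ∀ x → x ∈ xs)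
                       (P : ℕ → X → Set) (P? : ∀ m x → Dec (P m x))
                       (increasing : ∀ m x → P m x → P (suc m) x)
                       (persistent : ∀ m → Stationary P m → Stationary P (suc m)) where

    size : ℕ → ℕ
    size m = countSat (P? m) xs

    stationary-or-new : ∀ m → Stationary P m ⊎ Any (λ x → P (suc m) x × ¬ P m x) xs
    stationary-or-new m with any? (λ x → P? (suc m) x ×-dec ¬? (P? m x)) xs
    ... | yes new = inj₂ new
    ... | no ¬new = inj₁ stay
      where
        stay : ∀ x → P (suc m) x → P m x
        stay x p′ with P? m x
        ... | yes p = p
        ... | no ¬p = ⊥-elim (¬new (lose (complete x) (p′ , ¬p)))

    growth : ∀ M → (∃[ m ] (m < M × Stationary P m)) ⊎ (M + size 0 ≤ size M)
    growth zero = inj₂ ≤-refl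
    growth (suc M) with growth M
    ... | inj₁ (m , m<M , st) = inj₁ (m , m≤n⇒m≤1+n m<M , st)
    ... | inj₂ grown with stationary-or-new M
    ...   | inj₁ st = inj₁ (M , ≤-refl , st)
    ...   | inj₂ new = inj₂ (≤-trans (s≤s grown) (countSat-strict (P? M) (P? (suc M)) (increasing M) xs new))

    stationary-forever : ∀ {m} → Stationary P m → ∀ t x → P (t + m) x → P m x
    stationary-forever st zero x p = p
    stationary-forever {m} st (suc t) x p = stationary-forever st t x (later t x p)
      where
        later : ∀ t → Stationary P (t + m)
        later zero = st
        later (suc t) = persistent _ (later t)

    increasing-by : ∀ {m} t x → P m x → P (t + m) x
    increasing-by zero x p = p
    increasing-by (suc t) x p = increasing _ x (increasing-by t x p)

    stabilises : ∀ {x₀} → P 0 x₀ → ∃[ m ] (m < length xs × (∀ x n → P n x → P m x))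
    stabilises {x₀} p₀ with growth (length xs)
    ... | inj₂ grown = ⊥-elim (<-irrefl refl (≤-trans too-many (countSat-≤ (P? (length xs)) xs)))
      where
        too-many : length xs < size (length xs)
        too-many = ≤-trans (subst (_≤ length xs + size 0) (+-comm (length xs) 1)
                     (+-monoʳ-≤ (length xs) (countSat-positive (P? 0) xs (complete x₀) p₀))) grown
    ... | inj₁ (m , m<|xs| , st) = m , m<|xs| , constant
      where
        constant : ∀ x n → P n x → P m x
        constant x n p with n ≤? m
        ... | yes n≤m = subst (λ k → P k x) (m∸n+n≡m n≤m) (increasing-by (m ∸ n) x p)
        ... | no  n≰m = stationary-forever st (n ∸ m) x
                          (subst (λ k → P k x) (sym (m∸n+n≡m (≰⇒≥ n≰m))) p)

length-cartesianProduct : {A B : Set} (xs : List A) (ys : List B) →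
  length (cartesianProduct xs ys) ≡ length xs * length ys
length-cartesianProduct [] ys = refl
length-cartesianProduct (x ∷ xs) ys =
  trans (length-++ (map (x ,_) ys)) (cong₂ _+_ (length-map (x ,_) ys) (length-cartesianProduct xs ys))

length-allFin : ∀ d → length (allFin d) ≡ d
length-allFin d = length-tabulate {n = d} (λ x → x)

occurs-length : {w v : Word d} {i : ℕ} → OccursAt w v i → i + length w ≤ length v
occurs-length {w = w} (p , s , refl , refl) = begin
  length p + length w                 ≤⟨ m≤m+n _ (length s) ⟩
  length p + length w + length s      ≡⟨ +-assoc (length p) (length w) (length s) ⟩
  length p + (length w + length s)    ≡⟨ cong (length p +_) (length-++ w) ⟨
  length p + length (w ++ s)          ≡⟨ length-++ p ⟨
  length (p ++ w ++ s)                ∎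
  where open ≤-Reasoning

occurs-++ʳ : {w v : Word d} {i : ℕ} (r : Word d) → OccursAt w v i → OccursAt w (v ++ r) i
occurs-++ʳ {w = w} r (p , s , len , refl) =
  p , s ++ r , len , trans (cong (p ++_) (sym (++-assoc w s r))) (sym (++-assoc p (w ++ s) r))

occurs-++ˡ : {w v : Word d} {i : ℕ} (q : Word d) → OccursAt w v i → OccursAt w (q ++ v) (length q + i)
occurs-++ˡ {w = w} q (p , s , refl , refl) = q ++ p , s , length-++ q , ++-assoc q p (w ++ s)

occurs-++ˡ⁻ : {w : Word d} (q v : Word d) {t : ℕ} → OccursAt w (q ++ v) (length q + t) → OccursAt w v t
occurs-++ˡ⁻ [] v occ = occ
occurs-++ˡ⁻ (z ∷ q) v ([] , s , () , eq)
occurs-++ˡ⁻ (z ∷ q) v (_ ∷ p , s , len , eq) = occurs-++ˡ⁻ q v (p , s , suc-injective len , ∷-injectiveʳ eq)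

prefix-of-++ : (w s v r : Word d) → w ++ s ≡ v ++ r → length w ≤ length v → ∃[ s′ ] (v ≡ w ++ s′)
prefix-of-++ [] s v r eq _ = v , refl
prefix-of-++ (x ∷ w) s (y ∷ v) r eq (s≤s len) with ∷-injectiveˡ eq | prefix-of-++ w s v r (∷-injectiveʳ eq) len
... | refl | s′ , eq′ = s′ , cong (x ∷_) eq′

occurs-++ʳ⁻ : {w : Word d} (v r : Word d) {t : ℕ} → OccursAt w (v ++ r) t → t + length w ≤ length v →
  OccursAt w v t
occurs-++ʳ⁻ {w = w} v r (p , s , refl , eq) fits = go p v eq fits
  where
    go : ∀ p v → p ++ w ++ s ≡ v ++ r → length p + length w ≤ length v → OccursAt w v (length p)
    go [] v eq fits with prefix-of-++ w s v r eq fits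
    ... | s′ , eq′ = [] , s′ , refl , sym eq′
    go (_ ∷ p) (y ∷ v) eq (s≤s fits) with go p v (∷-injectiveʳ eq) fits
    ... | p′ , s′ , len , eq′ = y ∷ p′ , s′ , cong suc len , cong (y ∷_) eq′

adj⇒occurs : {x y : Fin d} {v : Word d} → Adj x y v → ∃[ q ] OccursAt (x ∷ y ∷ []) v q
adj⇒occurs (here {u}) = 0 , [] , u , refl , refl
adj⇒occurs (there {z} adj) with adj⇒occurs adj
... | q , p , s , len , eq = suc q , z ∷ p , s , cong suc len , cong (z ∷_) eq

module Blocks (w : Word d) (B : Morphism d) (L : ℕ) (w-nonEmpty : 1 ≤ length w)
              (short : ∀ c → length (B c) ≤ L) (dense : ∀ c → ∃[ q ] OccursAt w (B c) q) where

  occurrence-early : ∀ c {q} → OccursAt w (B c) q → q < L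
  occurrence-early c {q} occ = begin-strict
    q               <⟨ m<m+n q w-nonEmpty ⟩
    q + length w    ≤⟨ occurs-length occ ⟩
    length (B c)    ≤⟨ short c ⟩
    L               ∎
    where open ≤-Reasoning

  -- After each position x of B(u), the word ends within L letters or w occurs
  -- again within the next 2L positions: the occurrence in the next block.
  next-occurrence : ∀ u x → (length (apply B u) ≤ x + L) ⊎
    (∃[ δ ] (0 < δ × δ ≤ 2 * L × OccursAt w (apply B u) (x + δ)))
  next-occurrence [] x = inj₁ z≤n
  next-occurrence (c ∷ u) x with x <? length (B c)
  next-occurrence (c ∷ []) x | yes x<|Bc| =
    inj₁ (subst (_≤ x + L) (sym (cong length (++-identityʳ (B c)))) (≤-trans (short c) (m≤n+m L x)))
  next-occurrence (c ∷ c′ ∷ u) x | yes x<|Bc| with dense c′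
  ... | q , occ = inj₂ (δ , 0<δ , δ≤2L , subst (OccursAt w _) at (occurs-++ˡ (B c) (occurs-++ʳ (apply B u) occ)))
    where
      δ = (length (B c) ∸ x) + q
      at : length (B c) + q ≡ x + δ
      at = trans (cong (_+ q) (sym (m+[n∸m]≡n (<⇒≤ x<|Bc|)))) (+-assoc x _ q)
      0<δ : 0 < δ
      0<δ = <-≤-trans (m<n⇒0<n∸m x<|Bc|) (m≤m+n _ q)
      δ≤2L : δ ≤ 2 * L
      δ≤2L = subst (δ ≤_) (cong (L +_) (sym (+-identityʳ L)))
               (+-mono-≤ (≤-trans (m∸n≤m _ x) (short c)) (<⇒≤ (occurrence-early c′ occ)))
  next-occurrence (c ∷ u) x | no x≮|Bc| with x ∸ length (B c) | m+[n∸m]≡n (≮⇒≥ x≮|Bc|)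
  ... | x′ | refl with next-occurrence u x′
  ... | inj₁ ends = inj₁ (begin
        length (B c ++ apply B u)          ≡⟨ length-++ (B c) ⟩
        length (B c) + length (apply B u)  ≤⟨ +-monoʳ-≤ (length (B c)) ends ⟩
        length (B c) + (x′ + L)            ≡⟨ +-assoc (length (B c)) x′ L ⟨
        length (B c) + x′ + L              ∎)
    where open ≤-Reasoning
  ... | inj₂ (δ , 0<δ , δ≤2L , occ) =
        inj₂ (δ , 0<δ , δ≤2L , subst (OccursAt w _) (sym (+-assoc (length (B c)) x′ δ)) (occurs-++ˡ (B c) occ))

  successive-occurrences-close : ∀ {u v i j} → Factor v (apply B u) → SuccessiveOcc w v i j → j ∸ i ≤ 2 * L
  successive-occurrences-close {u} {v} {i} {j} (p , s , eq) (i<j , occ-i , occ-j , none)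
    with next-occurrence u (length p + i)
  ... | inj₁ ends = ≤-trans (m≤n+o⇒m∸n≤o j i (<⇒≤ j<i+L)) (m≤m+n L _)
    where
      j<i+L : j < i + L
      j<i+L = +-cancelˡ-< (length p) j (i + L) (begin-strict
        length p + j                        <⟨ +-monoʳ-< (length p) (m<m+n j w-nonEmpty) ⟩
        length p + (j + length w)           ≤⟨ +-monoʳ-≤ (length p) (occurs-length occ-j) ⟩
        length p + length v                 ≤⟨ +-monoʳ-≤ (length p) (m≤m+n (length v) (length s)) ⟩
        length p + (length v + length s)    ≡⟨ cong (length p +_) (length-++ v) ⟨
        length p + length (v ++ s)          ≡⟨ length-++ p ⟨
        length (p ++ v ++ s)                ≡⟨ cong length eq ⟩
        length (apply B u)                  ≤⟨ ends ⟩
        length p + i + L                    ≡⟨ +-assoc (length p) i L ⟩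
        length p + (i + L)                  ∎)
        where open ≤-Reasoning
  ... | inj₂ (δ , 0<δ , δ≤2L , occ) with j ∸ i ≤? 2 * L
  ...   | yes close = close
  ...   | no far = ⊥-elim (none (i + δ) (m<m+n i 0<δ) i+δ<j occ-in-v)
    where
      i+δ<j : i + δ < j
      i+δ<j = subst (i + δ <_) (m+[n∸m]≡n (<⇒≤ i<j)) (+-monoʳ-< i (≤-<-trans δ≤2L (≰⇒> far)))
      occ-in-pvs : OccursAt w (p ++ v ++ s) (length p + (i + δ))
      occ-in-pvs = subst₂ (OccursAt w) (sym eq) (+-assoc (length p) i δ) occ
      occ-in-v : OccursAt w v (i + δ)
      occ-in-v = occurs-++ʳ⁻ v s (occurs-++ˡ⁻ p (v ++ s) occ-in-pvs)
                   (≤-trans (+-monoˡ-≤ (length w) (<⇒≤ i+δ<j)) (occurs-length occ-j))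

module Prolongable (σ : Morphism d) (a : Fin d) (ne : NonErasing σ) (prim : Primitive σ)
                   (prolongable : ProlongableOn σ a) where

  open PairsOfImage σ ne

  k : ℕ
  k = proj₁ prim

  in-pow-k : ∀ i j → i ∈ pow σ k j
  in-pow-k i j = matPow-positive⇒∈ σ k i j (proj₂ prim i j)

  u : Word d
  u = proj₁ prolongable

  σa≡au : σ a ≡ a ∷ u
  σa≡au = proj₁ (proj₂ prolongable)

  u-nonEmpty : NonEmpty u
  u-nonEmpty with u | proj₂ (proj₂ prolongable)
  ... | []    | u≢[] = ⊥-elim (u≢[] refl)
  ... | h ∷ t | _    = h , t , refl

  pow-a-suc : ∀ m → pow σ (suc m) a ≡ pow σ m a ++ apply (pow σ m) u
  pow-a-suc m = trans (pow-suc-inner σ m a) (cong (apply (pow σ m)) σa≡au)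

  pow-a-prefix : ∀ {m n} → m ≤′ n → ∃[ r ] (pow σ n a ≡ pow σ m a ++ r)
  pow-a-prefix ≤′-refl = [] , sym (++-identityʳ _)
  pow-a-prefix {m} (≤′-step {n} m≤′n) with pow-a-prefix m≤′n
  ... | r , eq = r ++ apply (pow σ n) u ,
        trans (pow-a-suc n) (trans (cong (_++ apply (pow σ n) u) eq) (++-assoc (pow σ m a) r _))

  adj-pow-a-mono : ∀ {x y m n} → m ≤ n → Adj x y (pow σ m a) → Adj x y (pow σ n a)
  adj-pow-a-mono m≤n adj with pow-a-prefix (≤⇒≤′ m≤n)
  ... | r , eq = subst (Adj _ _) (sym eq) (adj-++⁺ˡ _ r adj)

  factor-pow-a-mono : ∀ {v m n} → m ≤ n → Factor v (pow σ m a) → Factor v (pow σ n a)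
  factor-pow-a-mono m≤n fac with pow-a-prefix (≤⇒≤′ m≤n)
  ... | r , eq = subst (Factor _) (sym eq) (factor-++ʳ r fac)

  pow-a-long : ∀ m → Long (pow σ (suc m) a)
  pow-a-long m = subst Long (sym (pow-a-suc m))
    (long-++ (pow σ m a) _ (pow-nonErasing σ ne m a) (apply-nonEmpty (pow σ m) (pow-nonErasing σ ne m) u u-nonEmpty))

  language-in-orbit : ∀ {v} → InLanguage σ v → ∃[ n ] Factor v (pow σ n a)
  language-in-orbit {v} (n , b , fac) = n + k ,
    subst (Factor v) (sym (pow-+ σ n k a)) (factor-apply (pow σ n) (pow σ k a) (in-pow-k b a) fac)

  language-in-image : ∀ K {v} → InLanguage σ v → ∃[ w ] Factor v (apply (pow σ K) w)
  language-in-image K v∈L with language-in-orbit v∈L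
  ... | n , fac = pow σ n a , subst (Factor _) (pow-+ σ K n a) (factor-pow-a-mono (m≤n+m n K) fac)

  -- The chain of letters e with a ∈ σ^m(e) stabilises before d steps; with
  -- primitivity, a occurs in σ^{m_a}(e) for every letter e.
  a-in-every-image : ∃[ m ] (m < d × (∀ e → a ∈ pow σ m e))
  a-in-every-image with Stabilisation.stabilises (allFin d) ∈-allFin
                           (λ m e → a ∈ pow σ m e) (λ m e → a ∈? pow σ m e) increasing persistent (here refl)
    where
      open import Data.List.Membership.DecPropositional (_≟_ {d}) using (_∈?_)
      a∈σa : a ∈ σ a
      a∈σa = subst (a ∈_) (sym σa≡au) (here refl)
      increasing : ∀ m e → a ∈ pow σ m e → a ∈ pow σ (suc m) e
      increasing m e a∈ = ∈-apply⁺ σ a∈ a∈σa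
      -- a ∈ σ^{m+2}(e) = σ^{m+1}(σ e) means a ∈ σ^{m+1}(z) for a letter z of σ(e)
      persistent : ∀ m → Stationary (λ m e → a ∈ pow σ m e) m → Stationary (λ m e → a ∈ pow σ m e) (suc m)
      persistent m st e a∈ with ∈-apply⁻ (pow σ (suc m)) (σ e) (subst (a ∈_) (pow-suc-inner σ (suc m) e) a∈)
      ... | z , z∈σe , a∈z = subst (a ∈_) (sym (pow-suc-inner σ m e)) (∈-apply⁺ (pow σ m) z∈σe (st z a∈z))
  ... | m , m<d , constant = m , subst (m <_) (length-allFin d) m<d , λ e → constant e k (in-pow-k a e)

  pairs-stabilise : ∃[ m ] (m < d * d × (∀ x y n → Adj x y (pow σ n a) → Adj x y (pow σ (suc m) a)))
  pairs-stabilise with Stabilisation.stabilises allPairs complete PairAt (λ m (x , y) → adj? x y (pow σ (suc m) a))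
                         increasing persistent (proj₂ (proj₂ (long⇒adj (pow-a-long 0))))
    where
      allPairs : List (Fin d × Fin d)
      allPairs = cartesianProduct (allFin d) (allFin d)
      complete : ∀ xy → xy ∈ allPairs
      complete (x , y) = ∈-cartesianProduct⁺ (∈-allFin x) (∈-allFin y)
      PairAt : ℕ → Fin d × Fin d → Set
      PairAt m (x , y) = Adj x y (pow σ (suc m) a)
      increasing : ∀ m xy → PairAt m xy → PairAt (suc m) xy
      increasing m (x , y) = adj-pow-a-mono (n≤1+n (suc m))
      -- σ^{m+2}(a) is long, so its pairs determine those of σ^{m+3}(a)
      persistent : ∀ m → Stationary PairAt m → Stationary PairAt (suc m)
      persistent m st (x , y) = pairs-apply (pow σ (suc (suc m)) a) (pow σ (suc m) a) (pow-a-long (suc m))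
                                  (λ x y → st (x , y)) x y
  ... | m , m<|pairs| , constant = m , subst (m <_) |pairs| m<|pairs| ,
        λ x y n adj → constant (x , y) n (adj-pow-a-mono (n≤1+n n) adj)
    where
      |pairs| : length (cartesianProduct (allFin d) (allFin d)) ≡ d * d
      |pairs| = trans (length-cartesianProduct (allFin d) (allFin d)) (cong₂ _*_ (length-allFin d) (length-allFin d))

  -- Every two-letter word of the language occurs in σ^{2d²}(c) for every letter c:
  -- xy ⊑ σ^{m+1}(a) ⊑ σ^{2d² - m_a}(a) ⊑ σ^{2d² - m_a}(σ^{m_a}(c)).
  pair-in-every-block : ∀ {x y} → InLanguage σ (x ∷ y ∷ []) → ∀ c → Adj x y (pow σ (2 * (d * d)) c)
  pair-in-every-block {x} {y} xy∈L c with language-in-orbit xy∈L | a-in-every-image | pairs-stabilise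
  ... | n , fac | mₐ , mₐ<d , a∈ | m , m<d² , constant =
    subst (λ N → Adj x y (pow σ N c)) (m∸n+n≡m mₐ≤K)
      (subst (Adj x y) (sym (pow-+ σ (K ∸ mₐ) mₐ c))
        (PairsOfImage.adj-apply-inside (pow σ (K ∸ mₐ)) (pow-nonErasing σ ne (K ∸ mₐ)) (pow σ mₐ c) (a∈ c)
          (adj-pow-a-mono (m+n≤o⇒m≤o∸n (suc m) m+mₐ<K) (constant x y n (Factor⇒Adj fac)))))
    where
      K = 2 * (d * d)
      n≤n*n : ∀ n → n ≤ n * n
      n≤n*n zero    = z≤n
      n≤n*n (suc n) = m≤m*n (suc n) (suc n)
      m+mₐ<K : suc m + mₐ ≤ K
      m+mₐ<K = subst (suc m + mₐ ≤_) (cong (d * d +_) (sym (+-identityʳ (d * d))))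
                 (+-mono-≤ m<d² (≤-trans (<⇒≤ mₐ<d) (n≤n*n d)))
      mₐ≤K : mₐ ≤ K
      mₐ≤K = m+n≤o⇒n≤o (suc m) m+mₐ<K

-- R_σ ≤ 2|σ^{2d²}|: apply the gap bound to the blocks σ^{2d²}(c), each of which
-- contains the given pair, in the image σ^{2d²}(w) containing v.
lemma18 : (d : ℕ) (σ : Morphism d) (a : Fin d) →
    Growing σ → Primitive σ → ProlongableOn σ a →
    ReturnBound σ (2 * maxLen (pow σ (2 * (d * d))))
lemma18 d σ a growing prim prolongable = bound
  where
    open Prolongable σ a (growing⇒nonErasing σ growing) prim prolongable
    K = 2 * (d * d)
    bound : ReturnBound σ (2 * maxLen (pow σ K))
    bound (x ∷ y ∷ []) v i j xy∈L refl v∈L successive with language-in-image K v∈L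
    ... | w , v⊑σᴷw = Blocks.successive-occurrences-close (x ∷ y ∷ []) (pow σ K) (maxLen (pow σ K))
                        (s≤s z≤n) (maxLen-≥ (pow σ K)) (λ c → adj⇒occurs (pair-in-every-block xy∈L c))
                        {u = w} v⊑σᴷw successive
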